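{- Let $p$ be a prime and let $G$ be a subgroup of $\mathrm{ST}_2(\mathbb{F}_p)$ such that the number of orbits of $G$ acting (on the left, by matrix multiplication) on $\mathcal M_p$ is at most $2$. Then $G=\mathrm{ST}_2(\mathbb{F}_p)$.
   Context: $\mathrm{ST}_2(\mathbb{F}_p)$ denotes the group of upper triangular $2\times2$ matrices over $\mathbb{F}_p$ with determinant $1$. $\mathcal M_p$ denotes the set of elements of exact order $p$ in $\mathbb{Z}/p\mathbb{Z}\times\mathbb{Z}/p\mathbb{Z}$ (viewed as column vectors), i.e. the nonzero vectors. (For $-I\in\Gamma$, this orbit count equals the number of cusps of the congruence subgroup $\Gamma$ with image $G$ mod $p$.) -}

module Defs where

open import Data.Nat using (ℕ; NonZero)
import Data.Nat as ℕ
open import Data.Nat.DivMod using (_mod_)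
open import Data.Fin using (Fin; toℕ; zero)
open import Data.Product using (_×_; _,_; Σ; ∃)
open import Data.Sum using (_⊎_)
open import Relation.Binary.PropositionalEquality using (_≡_)
open import Relation.Nullary using (¬_)
open import Level using (Level; suc; _⊔_) renaming (zero to lzero)

module _ (p : ℕ) .{{_ : NonZero p}} where

  F : Set
  F = Fin p

  _+F_ : F → F → F
  x +F y = (toℕ x ℕ.+ toℕ y) mod p

  _*F_ : F → F → F
  x *F y = (toℕ x ℕ.* toℕ y) mod p

  0F : F
  0F = 0 mod p

  1F : F
  1F = 1 mod p

  record Mat : Set where
    constructor mat
    field
      a b c d : F

  Vec2 : Set
  Vec2 = F × F

  I : Mat
  I = mat 1F 0F 0F 1F

  _⊗_ : Mat → Mat → Mat
  mat a b c d ⊗ mat a' b' c' d' =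
    mat ((a *F a') +F (b *F c')) ((a *F b') +F (b *F d'))
        ((c *F a') +F (d *F c')) ((c *F b') +F (d *F d'))

  _·_ : Mat → Vec2 → Vec2
  mat a b c d · (x , y) = ((a *F x) +F (b *F y)) , ((c *F x) +F (d *F y))

  det : Mat → F
  det (mat a b c d) = (a *F d) +F (((p ℕ.∸ 1) mod p) *F (b *F c))

  InST2 : Mat → Set
  InST2 m = (Mat.c m ≡ 0F) × (det m ≡ 1F)

  record IsSubgroupST2 {ℓ : Level} (G : Mat → Set ℓ) : Set ℓ where
    field
      ⊆ST2  : ∀ g → G g → InST2 g
      has-I : G I
      ⊗-closed : ∀ g h → G g → G h → G (g ⊗ h)
      inv-closed : ∀ g → G g → Σ Mat (λ h → G h × (h ⊗ g ≡ I))

  -- 𝓜_p : elements of exact order p in (Z/p)², i.e. nonzero vectors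
  InMp : Vec2 → Set
  InMp v = ¬ (v ≡ (0F , 0F))

  InOrbit : {ℓ : Level} → (Mat → Set ℓ) → Vec2 → Vec2 → Set ℓ
  InOrbit G v w = Σ Mat (λ g → G g × (g · v ≡ w))

  AtMostTwoOrbits : {ℓ : Level} → (Mat → Set ℓ) → Set ℓ
  AtMostTwoOrbits G =
    Σ Vec2 (λ v₁ → Σ Vec2 (λ v₂ → InMp v₁ × InMp v₂ ×
      (∀ w → InMp w → InOrbit G v₁ w ⊎ InOrbit G v₂ w)))

{-# OPTIONS --safe #-}
-- ST₂(F_p) preserves the line F_p e₁, so the nonzero vectors on it and those
-- off it are unions of orbits; both kinds occur, so with at most two orbits G
-- is transitive on the vectors off the line. An element of ST₂(F_p) is
-- determined by its second column g e₂, which lies off the line, so every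
-- g ∈ ST₂(F_p) agrees on e₂ with some h ∈ G and therefore equals it.
module Submission where

open import Defs hiding (_⊗_; _·_)
import Defs
open import Data.Nat using (ℕ; NonZero)
import Data.Nat as ℕ
import Data.Nat.Properties as ℕ
open import Data.Nat.DivMod using (_mod_; _%_; %-distribˡ-+; %-distribˡ-*; m<n⇒m%n≡m; m%n<n)
open import Data.Nat.Primality using (Prime; prime)
open import Data.Nat.Tactic.RingSolver using (solve-∀)
open import Data.Fin using (toℕ)
open import Data.Fin.Properties using (toℕ<n; toℕ-fromℕ<; toℕ-injective)
open import Data.Product using (Σ; _,_; proj₁; proj₂)
open import Data.Sum using (_⊎_; inj₁; inj₂; swap)
open import Function using (_∘_; _⇔_; mk⇔; Equivalence)
open import Relation.Nullary using (¬_; contradiction)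
open import Relation.Binary.PropositionalEquality
import Algebra.Definitions
open import Level using (Level)

row-expansion : ∀ a b a′ b′ c′ d′ x y →
  (a ℕ.* a′ ℕ.+ b ℕ.* c′) ℕ.* x ℕ.+ (a ℕ.* b′ ℕ.+ b ℕ.* d′) ℕ.* y
    ≡ a ℕ.* (a′ ℕ.* x ℕ.+ b′ ℕ.* y) ℕ.+ b ℕ.* (c′ ℕ.* x ℕ.+ d′ ℕ.* y)
row-expansion = solve-∀

module _ (p : ℕ) .{{_ : NonZero p}} where

  infixl 6 _+_
  infixl 7 _*_
  infixr 7 _⊗_
  infixr 6 _·_

  _+_ : F p → F p → F p
  _+_ = _+F_ p

  _*_ : F p → F p → F p
  _*_ = _*F_ p

  _⊗_ : Mat p → Mat p → Mat p
  _⊗_ = Defs._⊗_ p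

  _·_ : Mat p → Vec2 p → Vec2 p
  _·_ = Defs._·_ p

  -- An identity in F_p is proved by exhibiting natural numbers that both sides
  -- are residues of and proving them equal in ℕ.
  infix 4 _≈ᴺ_
  _≈ᴺ_ : F p → ℕ → Set
  x ≈ᴺ n = toℕ x ≡ n % p

  ≈ᴺ-mod : ∀ n → n mod p ≈ᴺ n
  ≈ᴺ-mod n = toℕ-fromℕ< (m%n<n n p)

  ⟨_⟩ : ∀ x → x ≈ᴺ toℕ x
  ⟨ x ⟩ = sym (m<n⇒m%n≡m (toℕ<n x))

  ≈ᴺ-0 : 0F p ≈ᴺ 0
  ≈ᴺ-0 = ≈ᴺ-mod 0

  ≈ᴺ-1 : 1F p ≈ᴺ 1
  ≈ᴺ-1 = ≈ᴺ-mod 1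

  infixl 6 _⊕_
  infixl 7 _⊛_

  _⊕_ : ∀ {x y m n} → x ≈ᴺ m → y ≈ᴺ n → x + y ≈ᴺ m ℕ.+ n
  _⊕_ {x} {y} {m} {n} x≈m y≈n = begin
    toℕ (x + y)                ≡⟨ ≈ᴺ-mod (toℕ x ℕ.+ toℕ y) ⟩
    (toℕ x ℕ.+ toℕ y) % p      ≡⟨ cong₂ (λ u v → (u ℕ.+ v) % p) x≈m y≈n ⟩
    (m % p ℕ.+ n % p) % p      ≡⟨ %-distribˡ-+ m n p ⟨
    (m ℕ.+ n) % p              ∎
    where open ≡-Reasoning

  _⊛_ : ∀ {x y m n} → x ≈ᴺ m → y ≈ᴺ n → x * y ≈ᴺ m ℕ.* n
  _⊛_ {x} {y} {m} {n} x≈m y≈n = begin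
    toℕ (x * y)                ≡⟨ ≈ᴺ-mod (toℕ x ℕ.* toℕ y) ⟩
    (toℕ x ℕ.* toℕ y) % p      ≡⟨ cong₂ (λ u v → (u ℕ.* v) % p) x≈m y≈n ⟩
    ((m % p) ℕ.* (n % p)) % p  ≡⟨ %-distribˡ-* m n p ⟨
    (m ℕ.* n) % p              ∎
    where open ≡-Reasoning

  ≈ᴺ⇒≡ : ∀ {x y m n} → x ≈ᴺ m → y ≈ᴺ n → m ≡ n → x ≡ y
  ≈ᴺ⇒≡ x≈m y≈n refl = toℕ-injective (trans x≈m (sym y≈n))

  open Algebra.Definitions {A = F p} _≡_

  +-identityˡ : LeftIdentity (0F p) _+_
  +-identityˡ x = ≈ᴺ⇒≡ (≈ᴺ-0 ⊕ ⟨ x ⟩) ⟨ x ⟩ refl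

  +-identityʳ : RightIdentity (0F p) _+_
  +-identityʳ x = ≈ᴺ⇒≡ (⟨ x ⟩ ⊕ ≈ᴺ-0) ⟨ x ⟩ (ℕ.+-identityʳ (toℕ x))

  *-identityˡ : LeftIdentity (1F p) _*_
  *-identityˡ x = ≈ᴺ⇒≡ (≈ᴺ-1 ⊛ ⟨ x ⟩) ⟨ x ⟩ (ℕ.*-identityˡ (toℕ x))

  *-identityʳ : RightIdentity (1F p) _*_
  *-identityʳ x = ≈ᴺ⇒≡ (⟨ x ⟩ ⊛ ≈ᴺ-1) ⟨ x ⟩ (ℕ.*-identityʳ (toℕ x))

  *-zeroˡ : LeftZero (0F p) _*_
  *-zeroˡ x = ≈ᴺ⇒≡ (≈ᴺ-0 ⊛ ⟨ x ⟩) ≈ᴺ-0 refl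

  *-zeroʳ : RightZero (0F p) _*_
  *-zeroʳ x = ≈ᴺ⇒≡ (⟨ x ⟩ ⊛ ≈ᴺ-0) ≈ᴺ-0 (ℕ.*-zeroʳ (toℕ x))

  *-assoc : Associative _*_
  *-assoc x y z =
    ≈ᴺ⇒≡ (⟨ x ⟩ ⊛ ⟨ y ⟩ ⊛ ⟨ z ⟩) (⟨ x ⟩ ⊛ (⟨ y ⟩ ⊛ ⟨ z ⟩)) (ℕ.*-assoc (toℕ x) (toℕ y) (toℕ z))

  *-comm : Commutative _*_
  *-comm x y = ≈ᴺ⇒≡ (⟨ x ⟩ ⊛ ⟨ y ⟩) (⟨ y ⟩ ⊛ ⟨ x ⟩) (ℕ.*-comm (toℕ x) (toℕ y))

  x*yz≡y*xz : ∀ x y z → x * (y * z) ≡ y * (x * z)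
  x*yz≡y*xz x y z = begin
    x * (y * z)  ≡⟨ *-assoc x y z ⟨
    x * y * z    ≡⟨ cong (_* z) (*-comm x y) ⟩
    y * x * z    ≡⟨ *-assoc y x z ⟩
    y * (x * z)  ∎
    where open ≡-Reasoning

  1F≢0F : 1 ℕ.< p → 1F p ≢ 0F p
  1F≢0F 1<p 1≡0 = contradiction 1≡0′ λ ()
    where
      1≡0′ : 1 ≡ 0
      1≡0′ = begin
        1          ≡⟨ m<n⇒m%n≡m 1<p ⟨
        1 % p      ≡⟨ ≈ᴺ-1 ⟨
        toℕ (1F p) ≡⟨ cong toℕ 1≡0 ⟩
        toℕ (0F p) ≡⟨ ≈ᴺ-0 ⟩
        0 % p      ≡⟨ m<n⇒m%n≡m (ℕ.>-nonZero⁻¹ p) ⟩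
        0          ∎
        where open ≡-Reasoning

  unit-cancelˡ : ∀ {a d y} → a * d ≡ 1F p → d * y ≡ 0F p → y ≡ 0F p
  unit-cancelˡ {a} {d} {y} ad≡1 dy≡0 = begin
    y            ≡⟨ *-identityˡ y ⟨
    1F p * y     ≡⟨ cong (_* y) ad≡1 ⟨
    a * d * y    ≡⟨ *-assoc a d y ⟩
    a * (d * y)  ≡⟨ cong (a *_) dy≡0 ⟩
    a * 0F p     ≡⟨ *-zeroʳ a ⟩
    0F p         ∎
    where open ≡-Reasoning

  inverse-unique : ∀ {a a′ d} → a′ * d ≡ 1F p → a * d ≡ 1F p → a′ ≡ a
  inverse-unique {a} {a′} {d} a′d≡1 ad≡1 = begin
    a′            ≡⟨ *-identityʳ a′ ⟨
    a′ * 1F p     ≡⟨ cong (a′ *_) ad≡1 ⟨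
    a′ * (a * d)  ≡⟨ x*yz≡y*xz a′ a d ⟩
    a * (a′ * d)  ≡⟨ cong (a *_) a′d≡1 ⟩
    a * 1F p      ≡⟨ *-identityʳ a ⟩
    a             ∎
    where open ≡-Reasoning

  ·-⊗ : ∀ A B v → (A ⊗ B) · v ≡ A · B · v
  ·-⊗ (mat a b c d) (mat a′ b′ c′ d′) (x , y) = cong₂ _,_ (row a b) (row c d)
    where
      row : ∀ a b → (a * a′ + b * c′) * x + (a * b′ + b * d′) * y
                      ≡ a * (a′ * x + b′ * y) + b * (c′ * x + d′ * y)
      row a b = ≈ᴺ⇒≡
        ((⟨ a ⟩ ⊛ ⟨ a′ ⟩ ⊕ ⟨ b ⟩ ⊛ ⟨ c′ ⟩) ⊛ ⟨ x ⟩ ⊕ (⟨ a ⟩ ⊛ ⟨ b′ ⟩ ⊕ ⟨ b ⟩ ⊛ ⟨ d′ ⟩) ⊛ ⟨ y ⟩)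
        (⟨ a ⟩ ⊛ (⟨ a′ ⟩ ⊛ ⟨ x ⟩ ⊕ ⟨ b′ ⟩ ⊛ ⟨ y ⟩) ⊕ ⟨ b ⟩ ⊛ (⟨ c′ ⟩ ⊛ ⟨ x ⟩ ⊕ ⟨ d′ ⟩ ⊛ ⟨ y ⟩))
        (row-expansion (toℕ a) (toℕ b) (toℕ a′) (toℕ b′) (toℕ c′) (toℕ d′) (toℕ x) (toℕ y))

  I· : ∀ v → I p · v ≡ v
  I· (x , y) = cong₂ _,_
    (trans (cong₂ _+_ (*-identityˡ x) (*-zeroˡ y)) (+-identityʳ x))
    (trans (cong₂ _+_ (*-zeroˡ x) (*-identityˡ y)) (+-identityˡ y))

  e₁ e₂ : Vec2 p
  e₁ = 1F p , 0F p
  e₂ = 0F p , 1F p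

  ·-e₂ : ∀ a b c d → mat a b c d · e₂ ≡ (b , d)
  ·-e₂ a b c d = cong₂ _,_ (second-entry a b) (second-entry c d)
    where
      second-entry : ∀ a b → a * 0F p + b * 1F p ≡ b
      second-entry a b = trans (cong₂ _+_ (*-zeroʳ a) (*-identityʳ b)) (+-identityˡ b)

  InST2⇒ad≡1 : ∀ g → InST2 p g → Mat.a g * Mat.d g ≡ 1F p
  InST2⇒ad≡1 (mat a b _ d) (refl , det≡1) = trans (sym det-upper) det≡1
    where
      det-upper : det p (mat a b (0F p) d) ≡ a * d
      det-upper = begin
        a * d + −1 * (b * 0F p)  ≡⟨ cong (λ z → a * d + −1 * z) (*-zeroʳ b) ⟩
        a * d + −1 * 0F p        ≡⟨ cong (a * d +_) (*-zeroʳ −1) ⟩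
        a * d + 0F p             ≡⟨ +-identityʳ (a * d) ⟩
        a * d                    ∎
        where
          open ≡-Reasoning
          −1 : F p
          −1 = (p ℕ.∸ 1) mod p

  OnAxis : Vec2 p → Set
  OnAxis v = proj₂ v ≡ 0F p

  ST2-preserves-axis : ∀ g → InST2 p g → ∀ v → OnAxis (g · v) ⇔ OnAxis v
  ST2-preserves-axis g@(mat a b c d) g∈ST2@(refl , _) (x , y) = mk⇔
    (λ dy≡0 → unit-cancelˡ {a} {d} (InST2⇒ad≡1 g g∈ST2) (trans (sym second) dy≡0))
    (λ { refl → trans second (*-zeroʳ d) })
    where
      second : 0F p * x + d * y ≡ d * y
      second = trans (cong (_+ d * y) (*-zeroˡ x)) (+-identityˡ (d * y))

  off-axis⇒InMp : ∀ {v} → ¬ OnAxis v → InMp p v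
  off-axis⇒InMp v∉axis v≡0 = v∉axis (cong proj₂ v≡0)

  ST2-determined-by-e₂ : ∀ g h → InST2 p g → InST2 p h → h · e₂ ≡ g · e₂ → h ≡ g
  ST2-determined-by-e₂ g@(mat a b c d) h@(mat a′ b′ c′ d′) g∈ST2@(refl , _) h∈ST2@(refl , _) he₂≡ge₂
    with refl ← trans (sym (·-e₂ a′ b′ c′ d′)) (trans he₂≡ge₂ (·-e₂ a b c d))
    = cong (λ a → mat a b c d) (inverse-unique {a} {a′} {d} (InST2⇒ad≡1 h h∈ST2) (InST2⇒ad≡1 g g∈ST2))

  module _ {ℓ : Level} {G : Mat p → Set ℓ} (G≤ST2 : IsSubgroupST2 p G) where
    open IsSubgroupST2 G≤ST2

    orbit-sym : ∀ {v w} → InOrbit p G v w → InOrbit p G w v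
    orbit-sym {v} (g , g∈G , refl) with h , h∈G , hg≡I ← inv-closed g g∈G =
      h , h∈G , trans (sym (·-⊗ h g v)) (trans (cong (_· v) hg≡I) (I· v))

    orbit-trans : ∀ {u v w} → InOrbit p G u v → InOrbit p G v w → InOrbit p G u w
    orbit-trans {u} (g , g∈G , refl) (h , h∈G , refl) = h ⊗ g , ⊗-closed h g h∈G g∈G , ·-⊗ h g u

    orbit-preserves-axis : ∀ {v w} → InOrbit p G v w → OnAxis w ⇔ OnAxis v
    orbit-preserves-axis {v} (g , g∈G , refl) = ST2-preserves-axis g (⊆ST2 g g∈G) v

    off-axis-in-orbit : ∀ {u v} → OnAxis v →
      (∀ w → InMp p w → InOrbit p G v w ⊎ InOrbit p G u w) →
      ∀ {w} → ¬ OnAxis w → InOrbit p G u w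
    off-axis-in-orbit v∈axis cover {w} w∉axis with cover w (off-axis⇒InMp w∉axis)
    ... | inj₁ v~w = contradiction (Equivalence.from (orbit-preserves-axis v~w) v∈axis) w∉axis
    ... | inj₂ u~w = u~w

    off-axis-single-orbit : 1 ℕ.< p → AtMostTwoOrbits p G →
      Σ (Vec2 p) λ u → ∀ {w} → ¬ OnAxis w → InOrbit p G u w
    off-axis-single-orbit 1<p (v₁ , v₂ , _ , _ , cover)
      with cover e₁ (λ e₁≡0 → 1F≢0F 1<p (cong proj₁ e₁≡0))
    ... | inj₁ v₁~e₁ = v₂ , off-axis-in-orbit (Equivalence.to (orbit-preserves-axis v₁~e₁) refl) cover
    ... | inj₂ v₂~e₁ = v₁ , off-axis-in-orbit (Equivalence.to (orbit-preserves-axis v₂~e₁) refl) (λ w → swap ∘ cover w)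

    transitive-off-axis : 1 ℕ.< p → AtMostTwoOrbits p G →
      ∀ {w w′} → ¬ OnAxis w → ¬ OnAxis w′ → InOrbit p G w w′
    transitive-off-axis 1<p orbits w∉axis w′∉axis with _ , u~ ← off-axis-single-orbit 1<p orbits =
      orbit-trans (orbit-sym (u~ w∉axis)) (u~ w′∉axis)

    e₂~g·e₂⇒g∈G : ∀ g → InST2 p g → InOrbit p G e₂ (g · e₂) → G g
    e₂~g·e₂⇒g∈G g g∈ST2 (h , h∈G , he₂≡ge₂) =
      subst G (ST2-determined-by-e₂ g h g∈ST2 (⊆ST2 h h∈G) he₂≡ge₂) h∈G

proposition3p5 : {ℓ : Level} (p : ℕ) .{{_ : NonZero p}} → Prime p →
    (G : Mat p → Set ℓ) → IsSubgroupST2 p G → AtMostTwoOrbits p G →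
    ∀ g → InST2 p g → G g
proposition3p5 p (prime {{nt}} _) G G≤ST2 orbits g g∈ST2 =
  e₂~g·e₂⇒g∈G p G≤ST2 g g∈ST2 (transitive-off-axis p G≤ST2 1<p orbits e₂∉axis g·e₂∉axis)
  where
    1<p : 1 ℕ.< p
    1<p = ℕ.nonTrivial⇒n>1 p {{nt}}
    e₂∉axis : ¬ OnAxis p (e₂ p)
    e₂∉axis = 1F≢0F p 1<p
    g·e₂∉axis : ¬ OnAxis p (_·_ p g (e₂ p))
    g·e₂∉axis = e₂∉axis ∘ Equivalence.to (ST2-preserves-axis p g g∈ST2 (e₂ p))
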